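{- Let $c,d$ be positive integers and $r\in\mathbb{Z}$. Assume that there are only finitely many natural numbers $n$ that cannot be written in the form $n=cp+T_x$ with $x\in\mathbb{Z}$, where $p$ is either $0$ or a prime with $p\equiv r\pmod d$. Then both $c$ and $d$ are powers of two, and $\gcd(r,d)=1$.
   Context: For $x\in\mathbb{Z}$, $T_x=x(x+1)/2$ denotes the $x$-th triangular number. Natural numbers are $0,1,2,\ldots$. Powers of two include $2^0=1$. -}

module Defs where

open import Data.Nat as ℕ using (ℕ)
open import Data.Nat.Primality using (Prime)
open import Data.Integer as ℤ using (ℤ; +_)
open import Data.Integer.Divisibility using (_∣_)
open import Data.Sum using (_⊎_)
open import Data.Product using (_×_; ∃-syntax)
open import Relation.Binary.PropositionalEquality using (_≡_)

-- T x = x(x+1)/2, the x-th triangular number (x ∈ ℤ); the division is exact.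
T : ℤ → ℤ
T x = (x ℤ.* (x ℤ.+ + 1)) ℤ./ + 2

_≡_[mod_] : ℕ → ℤ → ℕ → Set
p ≡ r [mod d ] = (+ d) ∣ ((+ p) ℤ.- r)

Admissible : ℤ → ℕ → ℕ → Set
Admissible r d p = (p ≡ 0) ⊎ (Prime p × p ≡ r [mod d ])

Representable : ℕ → ℤ → ℕ → ℕ → Set
Representable c r d n =
  ∃[ p ] ∃[ x ] (Admissible r d p × (+ n ≡ (+ c) ℤ.* (+ p) ℤ.+ T x))

IsPowerOfTwo : ℕ → Set
IsPowerOfTwo m = ∃[ k ] (m ≡ 2 ℕ.^ k)

{-# OPTIONS --safe #-}
-- Every T_x is a triangular number T_k with k : ℕ, so a representation gives 2n = 2cp + k(k+1).
-- Let an odd q ≥ 3 divide c or d. Then 2cp is constant mod q over the admissible primes p, while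
-- k(k+1) misses some residue mod q; as 2 is invertible mod q, some residue class mod q contains
-- no representable non-triangular n, yet it contains arbitrarily large non-triangular n (p = 0
-- yields only triangular numbers). So c and d are powers of two. If d and r are both even, the
-- only admissible prime is 2, and n = T_m + 2c + 1 with 2c < m is neither triangular nor 2c plus
-- a triangular number.

module Submission where

open import Defs
open import Data.Nat using (ℕ; _≤_; NonZero)
open import Data.Integer using (ℤ; +_)
open import Data.Integer.GCD using (gcd)
open import Data.Product using (_×_; ∃-syntax)
open import Relation.Binary.PropositionalEquality using (_≡_)

open import Function.Base using (_∘_)
open import Function.Definitions using (Injective)
open import Data.Empty using (⊥; ⊥-elim)
open import Data.Sum using (_⊎_; inj₁; inj₂; [_,_]′; fromInj₁)
open import Data.Product using (_,_; proj₁; proj₂; map; map₂)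
open import Data.List using (_∷_; [])
open import Data.Nat
  using (zero; suc; pred; _+_; _*_; _∸_; _^_; _<_; _%_; z≤n; s≤s; z<s; _≤?_; >-nonZero⁻¹)
open import Data.Nat.Properties hiding (_≟_)
open import Data.Nat.DivMod
  using (_/_; _mod_; m%n<n; m%n%n≡m%n; %-distribˡ-+; %-distribˡ-*; [m+kn]%n≡m%n;
         %-remove-+ˡ; %-remove-+ʳ; m<n⇒m%n≡m; m*n/n≡m; m*n%n≡0)
open import Data.Nat.Divisibility
  using (_∣_; _∣?_; ∣-trans; ∣-reflexive; ∣1⇒≡1; ∣m⇒∣m*n; ∣n⇒∣m*n; n∣m⇒m%n≡0)
open import Data.Nat.Coprimality using (Coprime; coprime-divisor)
import Data.Nat.GCD as ℕ
open import Data.Nat.GCD using (gcd[m,n]∣m; gcd[m,n]∣n)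
open import Data.Nat.Induction using (<-rec)
open import Data.Nat.Primality using (Prime; prime⇒irreducible; prime[2])
open import Data.Nat.Tactic.RingSolver using (solve)
import Data.Integer as ℤ
open import Data.Integer using (-[1+_]; _⊖_)
open import Data.Integer.DivMod using (div-pos-is-/ℕ)
import Data.Integer.Properties as ℤ
open import Data.Integer.Properties using (pos-*; pos-+; m-n≡m⊖n; ∣⊖∣-≤; ∣m⊖n∣≡∣n⊖m∣)
import Data.Integer.Divisibility.Signed as Signed
import Data.Fin as Fin
open import Data.Fin using (Fin; toℕ; fromℕ<; _≟_)
open import Data.Fin.Properties
  using (any?; all?; ¬∀⟶∃¬; injective⇒≤; toℕ-injective; toℕ-fromℕ<; toℕ<n)
open import Relation.Nullary using (¬_; yes; no; contradiction)
open import Relation.Binary.PropositionalEquality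
  using (_≢_; refl; sym; trans; cong; cong₂; subst; module ≡-Reasoning)
open ≡-Reasoning

tri : ℕ → ℕ
tri zero    = 0
tri (suc k) = tri k + suc k

tri[k]*2≡k*[1+k] : ∀ k → tri k * 2 ≡ k * suc k
tri[k]*2≡k*[1+k] zero    = refl
tri[k]*2≡k*[1+k] (suc k) = begin
  (tri k + suc k) * 2      ≡⟨ *-distribʳ-+ 2 (tri k) (suc k) ⟩
  tri k * 2 + suc k * 2    ≡⟨ cong (_+ suc k * 2) (tri[k]*2≡k*[1+k] k) ⟩
  k * suc k + suc k * 2    ≡⟨ solve (k ∷ []) ⟩
  suc k * suc (suc k)      ∎

n≤tri[n] : ∀ n → n ≤ tri n
n≤tri[n] zero    = z≤n
n≤tri[n] (suc n) = m≤n+m (suc n) (tri n)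

tri-mono-≤ : ∀ {m n} → m ≤ n → tri m ≤ tri n
tri-mono-≤ z≤n       = z≤n
tri-mono-≤ (s≤s m≤n) = +-mono-≤ (tri-mono-≤ m≤n) (s≤s m≤n)

tri[m]+j≢tri[k] : ∀ {m j} k → 0 < j → j ≤ m → tri m + j ≢ tri k
tri[m]+j≢tri[k] {m} {j} k 0<j j≤m eq with k ≤? m
... | yes k≤m = <⇒≱ (m<m+n (tri m) 0<j) (subst (_≤ tri m) (sym eq) (tri-mono-≤ k≤m))
... | no  k≰m = <⇒≱ (s≤s j≤m)
  (+-cancelˡ-≤ (tri m) _ _ (subst (tri (suc m) ≤_) (sym eq) (tri-mono-≤ (≰⇒> k≰m))))

x*[x+1]≡k*[1+k] : ∀ x → ∃[ k ] x ℤ.* (x ℤ.+ + 1) ≡ + (k * suc k)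
x*[x+1]≡k*[1+k] (+ k) = k , (begin
  + k ℤ.* + (k + 1)   ≡⟨ pos-* k (k + 1) ⟨
  + (k * (k + 1))     ≡⟨ cong (λ n → + (k * n)) (+-comm k 1) ⟩
  + (k * suc k)       ∎)
-- For x = −(k + 2) the product x (x + 1) normalises to + ((k + 2) (k + 1)).
x*[x+1]≡k*[1+k] -[1+ zero ]  = 0 , refl
x*[x+1]≡k*[1+k] -[1+ suc k ] = suc k , cong (+_) (*-comm (suc (suc k)) (suc k))

T≡tri : ∀ x → ∃[ k ] T x ≡ + tri k
T≡tri x with k , x*[x+1]≡ ← x*[x+1]≡k*[1+k] x = k , (begin
  T x                            ≡⟨ div-pos-is-/ℕ (x ℤ.* (x ℤ.+ + 1)) 2 ⟩
  x ℤ.* (x ℤ.+ + 1) ℤ./ℕ 2       ≡⟨ cong (ℤ._/ℕ 2) x*[x+1]≡ ⟩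
  + (k * suc k / 2)              ≡⟨ cong (λ n → + (n / 2)) (tri[k]*2≡k*[1+k] k) ⟨
  + (tri k * 2 / 2)              ≡⟨ cong (+_) (m*n/n≡m (tri k) 2) ⟩
  + tri k                        ∎)

representable⇒tri : ∀ {c r d n} → Representable c r d n →
                    ∃[ p ] ∃[ k ] (Admissible r d p × n ≡ c * p + tri k)
representable⇒tri {c} {n = n} (p , x , admissible , n≡) with k , Tx≡ ← T≡tri x =
  p , k , admissible , ℤ.+-injective (begin
    + n                       ≡⟨ n≡ ⟩
    + c ℤ.* + p ℤ.+ T x       ≡⟨ cong₂ ℤ._+_ (sym (pos-* c p)) Tx≡ ⟩
    + (c * p) ℤ.+ + tri k     ≡⟨ pos-+ (c * p) (tri k) ⟨
    + (c * p + tri k)         ∎)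

EventuallyRepresentable : ℕ → ℤ → ℕ → Set
EventuallyRepresentable c r d = ∃[ N ] ((n : ℕ) → N ≤ n → Representable c r d n)

¬surjective : ∀ {n} (f : Fin n → Fin (suc n)) → ∃[ b ] ∀ a → f a ≢ b
¬surjective {n} f with all? (λ b → any? (λ a → f a ≟ b))
... | no ¬covered = map₂ (λ ¬hit a fa≡b → ¬hit (a , fa≡b))
  (¬∀⟶∃¬ (suc n) _ (λ b → any? (λ a → f a ≟ b)) ¬covered)
... | yes covered = contradiction (injective⇒≤ section-injective) 1+n≰n
  where
  section-injective : Injective _≡_ _≡_ (proj₁ ∘ covered)
  section-injective {b} {b′} eq =
    trans (sym (proj₂ (covered b))) (trans (cong f eq) (proj₂ (covered b′)))

module Residues (q : ℕ) .{{_ : NonZero q}} where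

  infix 4 _≋_
  _≋_ : ℕ → ℕ → Set
  a ≋ b = a % q ≡ b % q

  %-≋ : ∀ a → a % q ≋ a
  %-≋ a = m%n%n≡m%n a q

  +-cong : ∀ {a b c d} → a ≋ b → c ≋ d → a + c ≋ b + d
  +-cong {a} {b} {c} {d} a≋b c≋d = begin
    (a + c) % q               ≡⟨ %-distribˡ-+ a c q ⟩
    (a % q + c % q) % q       ≡⟨ cong₂ (λ x y → (x + y) % q) a≋b c≋d ⟩
    (b % q + d % q) % q       ≡⟨ %-distribˡ-+ b d q ⟨
    (b + d) % q               ∎

  *-cong : ∀ {a b c d} → a ≋ b → c ≋ d → a * c ≋ b * d
  *-cong {a} {b} {c} {d} a≋b c≋d = begin
    (a * c) % q               ≡⟨ %-distribˡ-* a c q ⟩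
    (a % q * (c % q)) % q     ≡⟨ cong₂ (λ x y → (x * y) % q) a≋b c≋d ⟩
    (b % q * (d % q)) % q     ≡⟨ %-distribˡ-* b d q ⟨
    (b * d) % q               ∎

  -- pred q * a plays the role of − a, which ℕ lacks.
  x+a*q≡x+a+pred[q]*a : ∀ x a → x + a * q ≡ x + a + pred q * a
  x+a*q≡x+a+pred[q]*a x a = begin
    x + a * q                 ≡⟨ cong (λ n → x + a * n) (suc-pred q) ⟨
    x + a * suc (pred q)      ≡⟨ cong (_+_ x) (*-suc a (pred q)) ⟩
    x + (a + a * pred q)      ≡⟨ +-assoc x a (a * pred q) ⟨
    x + a + a * pred q        ≡⟨ cong (_+_ (x + a)) (*-comm a (pred q)) ⟩
    x + a + pred q * a        ∎

  +-cancelˡ : ∀ a {b c} → a + b ≋ a + c → b ≋ c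
  +-cancelˡ a {b} {c} a+b≋a+c = begin
    b % q                         ≡⟨ [m+kn]%n≡m%n b a q ⟨
    (b + a * q) % q               ≡⟨ cong (_% q) (shift b) ⟩
    (a + b + pred q * a) % q      ≡⟨ +-cong a+b≋a+c refl ⟩
    (a + c + pred q * a) % q      ≡⟨ cong (_% q) (shift c) ⟨
    (c + a * q) % q               ≡⟨ [m+kn]%n≡m%n c a q ⟩
    c % q                         ∎
    where
    shift : ∀ x → x + a * q ≡ a + x + pred q * a
    shift x = trans (x+a*q≡x+a+pred[q]*a x a) (cong (_+ pred q * a) (+-comm x a))

  residue-in-window : ∀ a t → ∃[ j ] (j < q × a + j ≋ t)
  residue-in-window a t = j , m%n<n _ q , (begin
    (a + j) % q                      ≡⟨ +-cong (refl {x = a % q}) (%-≋ _) ⟩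
    (a + (t + pred q * a)) % q       ≡⟨ cong (_% q) (+-assoc a t _) ⟨
    (a + t + pred q * a) % q         ≡⟨ cong (λ n → (n + pred q * a) % q) (+-comm a t) ⟩
    (t + a + pred q * a) % q         ≡⟨ cong (_% q) (x+a*q≡x+a+pred[q]*a t a) ⟨
    (t + a * q) % q                  ≡⟨ [m+kn]%n≡m%n t a q ⟩
    t % q                            ∎)
    where j = (t + pred q * a) % q

  ∸-≋ : ∀ {m n} → m ≤ n → q ∣ n ∸ m → m ≋ n
  ∸-≋ {m} {n} m≤n q∣n∸m = begin
    m % q                 ≡⟨ %-remove-+ʳ m q∣n∸m ⟨
    (m + (n ∸ m)) % q     ≡⟨ cong (_% q) (m+[n∸m]≡n m≤n) ⟩
    n % q                 ∎

  ∣⊖∣⇒≋ : ∀ m n → q ∣ ℤ.∣ m ⊖ n ∣ → m ≋ n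
  ∣⊖∣⇒≋ m n q∣m⊖n with ≤-total m n
  ... | inj₁ m≤n = ∸-≋ m≤n (subst (q ∣_) (∣⊖∣-≤ m≤n) q∣m⊖n)
  ... | inj₂ n≤m = sym (∸-≋ n≤m (subst (q ∣_) n⊖m≡m∸n q∣m⊖n))
    where n⊖m≡m∸n = trans (∣m⊖n∣≡∣n⊖m∣ m n) (∣⊖∣-≤ n≤m)

  ℤ-residue : ∀ r → ∃[ ρ ] ∀ {p} → q ∣ ℤ.∣ + p ℤ.- r ∣ → p ≋ ρ
  ℤ-residue (+ a) = a , λ {p} q∣p-a →
    ∣⊖∣⇒≋ p a (subst (q ∣_) (cong ℤ.∣_∣ (m-n≡m⊖n p a)) q∣p-a)
  ℤ-residue -[1+ a ] = pred q * suc a , λ {p} q∣p+1+a → begin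
    p % q                               ≡⟨ [m+kn]%n≡m%n p (suc a) q ⟨
    (p + suc a * q) % q                 ≡⟨ cong (_% q) (x+a*q≡x+a+pred[q]*a p (suc a)) ⟩
    (p + suc a + pred q * suc a) % q    ≡⟨ %-remove-+ˡ (pred q * suc a)
                                             (subst (q ∣_) (|p+1+a| p) q∣p+1+a) ⟩
    (pred q * suc a) % q                ∎
    where
    |p+1+a| : ∀ p → ℤ.∣ + p ℤ.- -[1+ a ] ∣ ≡ p + suc a
    |p+1+a| p = cong ℤ.∣_∣ (sym (pos-+ p (suc a)))

  k*[1+k]≋k%q*[1+k%q] : ∀ k → k * suc k ≋ (k % q) * suc (k % q)
  k*[1+k]≋k%q*[1+k%q] k = *-cong (sym (%-≋ k)) (+-cong {1} refl (sym (%-≋ k)))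

  nonTriangular-in-class : ∀ N t → ∃[ n ] (N ≤ n × n ≋ t × ∀ k → n ≢ tri k)
  nonTriangular-in-class N t = shifted (residue-in-window (suc (tri m)) t)
    where
    m = N + q
    shifted : ∃[ j ] (j < q × suc (tri m) + j ≋ t) →
              ∃[ n ] (N ≤ n × n ≋ t × ∀ k → n ≢ tri k)
    shifted (j , j<q , class) =
      tri m + suc j ,
      ≤-trans (m≤m+n N q) (≤-trans (n≤tri[n] m) (m≤m+n (tri m) (suc j))) ,
      trans (cong (_% q) (+-suc (tri m) j)) class ,
      λ k → tri[m]+j≢tri[k] k z<s (≤-trans j<q (m≤n+m q N))

  c*p-residue : ∀ {c d r} → q ∣ c ⊎ q ∣ d → ∃[ a ] ∀ {p} → p ≡ r [mod d ] → c * p ≋ a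
  c*p-residue {c} {d} {r} q∣c⊎q∣d with ρ , p≋ρ ← ℤ-residue r = c * ρ , class q∣c⊎q∣d
    where
    class : q ∣ c ⊎ q ∣ d → ∀ {p} → p ≡ r [mod d ] → c * p ≋ c * ρ
    class (inj₁ q∣c) {p} _ =
      trans (n∣m⇒m%n≡0 _ q (∣m⇒∣m*n p q∣c)) (sym (n∣m⇒m%n≡0 _ q (∣m⇒∣m*n ρ q∣c)))
    class (inj₂ q∣d) p≡r = *-cong {c} refl (p≋ρ (∣-trans q∣d p≡r))

  representable⇒≋a+tri : ∀ {c r d n a} → (∀ {p} → p ≡ r [mod d ] → c * p ≋ a) →
                         Representable c r d n → (∀ k → n ≢ tri k) → ∃[ k ] n ≋ a + tri k
  representable⇒≋a+tri {c} {r} {d} {n} class representable nonTriangular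
    with representable⇒tri {c} {r} {d} {n} representable
  ... | _ , k , inj₁ refl , n≡ =
    ⊥-elim (nonTriangular k (trans n≡ (cong (_+ tri k) (*-zeroʳ c))))
  ... | p , k , inj₂ (_ , p≡r) , n≡ =
    k , trans (cong (_% q) n≡) (+-cong (class {p} p≡r) refl)

-- k (k + 1) mod q takes the value 0 at both k = 0 and k = q − 1, so its values on the
-- first q − 1 residues are all of them, and one value is missed.
pronic-misses-residue : ∀ s → ∃[ b ] ∀ k → k * suc k % (2 + s) ≢ b % (2 + s)
pronic-misses-residue s = map toℕ missed⇒nonPronic (¬surjective f)
  where
  q = 2 + s
  open Residues q
  f : Fin (suc s) → Fin q
  f a = (toℕ a * suc (toℕ a)) mod q
  representative : ∀ k → ∃[ a ] toℕ a * suc (toℕ a) ≋ k * suc k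
  representative k with m<1+n⇒m<n∨m≡n (m%n<n k q)
  ... | inj₁ k%q<1+s = fromℕ< k%q<1+s , (begin
    toℕ (fromℕ< k%q<1+s) * suc (toℕ (fromℕ< k%q<1+s)) % q
      ≡⟨ cong (λ i → i * suc i % q) (toℕ-fromℕ< k%q<1+s) ⟩
    k % q * suc (k % q) % q
      ≡⟨ k*[1+k]≋k%q*[1+k%q] k ⟨
    k * suc k % q ∎)
  ... | inj₂ k%q≡1+s = Fin.zero , sym (begin
    k * suc k % q               ≡⟨ k*[1+k]≋k%q*[1+k%q] k ⟩
    k % q * suc (k % q) % q     ≡⟨ cong (λ i → i * suc i % q) k%q≡1+s ⟩
    suc s * q % q               ≡⟨ m*n%n≡0 (suc s) q ⟩
    0                           ∎)
  missed⇒nonPronic : ∀ {b} → (∀ a → f a ≢ b) → ∀ k → k * suc k % q ≢ toℕ b % q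
  missed⇒nonPronic {b} missed k k*[1+k]≋b with a , a≋k ← representative k =
    missed a (toℕ-injective (begin
      toℕ (f a)                 ≡⟨ toℕ-fromℕ< (m%n<n (toℕ a * suc (toℕ a)) q) ⟩
      toℕ a * suc (toℕ a) % q   ≡⟨ a≋k ⟩
      k * suc k % q             ≡⟨ k*[1+k]≋b ⟩
      toℕ b % q                 ≡⟨ m<n⇒m%n≡m (toℕ<n b) ⟩
      toℕ b                     ∎))

oddDivisor⇒¬eventuallyRepresentable : ∀ {c d r} h → 3 + 2 * h ∣ c ⊎ 3 + 2 * h ∣ d →
                                      ¬ EventuallyRepresentable c r d
oddDivisor⇒¬eventuallyRepresentable {c} {d} {r} h q∣c⊎q∣d (N , representable) =
  let a , c*p≋a                    = c*p-residue {c} {d} {r} q∣c⊎q∣d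
      b , nonPronic                = pronic-misses-residue (1 + 2 * h)
      n , N≤n , n≋ , nonTriangular = nonTriangular-in-class N (a + b * (2 + h))
      k , n≋a+tri[k]               = representable⇒≋a+tri {c} {r} {d} {n} {a}
                                       c*p≋a (representable n N≤n) nonTriangular
      tri[k]≋b*[2+h]               = +-cancelˡ a {tri k} {b * (2 + h)}
                                       (trans (sym n≋a+tri[k]) n≋)
  in nonPronic k (begin
    k * suc k % q             ≡⟨ cong (_% q) (tri[k]*2≡k*[1+k] k) ⟨
    tri k * 2 % q             ≡⟨ *-cong {tri k} {b * (2 + h)} {2} tri[k]≋b*[2+h] refl ⟩
    b * (2 + h) * 2 % q       ≡⟨ cong (_% q) (b*[2+h]*2≡b+b*q b) ⟩
    (b + b * q) % q           ≡⟨ [m+kn]%n≡m%n b b q ⟩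
    b % q                     ∎)
  where
  q = 3 + 2 * h
  open Residues q
  b*[2+h]*2≡b+b*q : ∀ b → b * (2 + h) * 2 ≡ b + b * (3 + 2 * h)
  b*[2+h]*2≡b+b*q b = solve (b ∷ h ∷ [])

evenResidue⇒prime≡2 : ∀ {d r p} → 2 ∣ d → 2 ∣ ℤ.∣ r ∣ → Prime p → p ≡ r [mod d ] → p ≡ 2
evenResidue⇒prime≡2 {d} {r} {p} 2∣d 2∣r p-prime p≡r =
  [ (λ ()) , sym ]′ (prime⇒irreducible p-prime 2∣p)
  where
  2∣p-r : + 2 Signed.∣ + p ℤ.- r
  2∣p-r = Signed.∣ᵤ⇒∣ {+ 2} {+ p ℤ.- r} (∣-trans 2∣d p≡r)
  2∣-r : + 2 Signed.∣ ℤ.- r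
  2∣-r = Signed.∣m⇒∣-m (Signed.∣ᵤ⇒∣ {+ 2} {r} 2∣r)
  2∣p : 2 ∣ p
  2∣p = Signed.∣⇒∣ᵤ {+ 2} {+ p} (Signed.∣m+n∣n⇒∣m 2∣p-r 2∣-r)

evenResidue⇒¬eventuallyRepresentable : ∀ {c d r} → 2 ∣ d → 2 ∣ ℤ.∣ r ∣ →
                                       ¬ EventuallyRepresentable c r d
evenResidue⇒¬eventuallyRepresentable {c} {d} {r} 2∣d 2∣r (N , representable) =
  excluded (representable⇒tri {c} {r} {d} {tri m + j} (representable (tri m + j) N≤n))
  where
  j = suc (c * 2)
  m = N + j
  j≤m : j ≤ m
  j≤m = m≤n+m j N
  N≤n : N ≤ tri m + j
  N≤n = ≤-trans (m≤m+n N j) (≤-trans (n≤tri[n] m) (m≤m+n (tri m) j))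
  excluded : ∃[ p ] ∃[ k ] (Admissible r d p × tri m + j ≡ c * p + tri k) → ⊥
  excluded (_ , k , inj₁ refl , eq) =
    tri[m]+j≢tri[k] k z<s j≤m (trans eq (cong (_+ tri k) (*-zeroʳ c)))
  excluded (p , k , inj₂ (p-prime , p≡r) , eq)
    with refl ← evenResidue⇒prime≡2 {d} {r} 2∣d 2∣r p-prime p≡r =
    tri[m]+j≢tri[k] k z<s (≤-trans (s≤s z≤n) j≤m) (+-cancelˡ-≡ (c * 2) _ _ (begin
      c * 2 + (tri m + 1)     ≡⟨ +-comm (c * 2) (tri m + 1) ⟩
      tri m + 1 + c * 2       ≡⟨ +-assoc (tri m) 1 (c * 2) ⟩
      tri m + j               ≡⟨ eq ⟩
      c * 2 + tri k           ∎))

parity : ∀ m → ∃[ k ] (m ≡ 2 * k ⊎ m ≡ 1 + 2 * k)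
parity zero = 0 , inj₁ refl
parity (suc m) with parity m
... | k , inj₁ refl = k , inj₂ refl
... | k , inj₂ refl = suc k , inj₁ (solve (k ∷ []))

powerOfTwo⊎oddDivisor : ∀ m → .{{NonZero m}} → IsPowerOfTwo m ⊎ ∃[ h ] 3 + 2 * h ∣ m
powerOfTwo⊎oddDivisor =
  <-rec (λ m → .{{NonZero m}} → IsPowerOfTwo m ⊎ ∃[ h ] 3 + 2 * h ∣ m) split
  where
  split : ∀ m → (∀ {k} → k < m → .{{NonZero k}} → IsPowerOfTwo k ⊎ ∃[ h ] 3 + 2 * h ∣ k) →
          .{{NonZero m}} → IsPowerOfTwo m ⊎ ∃[ h ] 3 + 2 * h ∣ m
  split m rec with parity m
  ... | zero  , inj₂ refl = inj₁ (0 , refl)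
  ... | suc h , inj₂ refl = inj₂ (h , ∣-reflexive (solve (h ∷ [])))
  ... | zero  , inj₁ refl with () ← >-nonZero⁻¹ 0
  ... | suc k , inj₁ refl with rec {suc k} (m<m+n (suc k) z<s)
  ...   | inj₁ (j , 1+k≡2^j) = inj₁ (suc j , cong (2 *_) 1+k≡2^j)
  ...   | inj₂ (h , q∣1+k)   = inj₂ (h , ∣n⇒∣m*n 2 q∣1+k)

∣p^k⇒≡1⊎p∣ : ∀ {p m} → Prime p → ∀ k → m ∣ p ^ k → m ≡ 1 ⊎ p ∣ m
∣p^k⇒≡1⊎p∣ _ zero m∣1 = inj₁ (∣1⇒≡1 m∣1)
∣p^k⇒≡1⊎p∣ {p} {m} p-prime (suc k) m∣p^[1+k] with p ∣? m
... | yes p∣m = inj₂ p∣m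
... | no  p∤m = ∣p^k⇒≡1⊎p∣ p-prime k (coprime-divisor coprime m∣p^[1+k])
  where
  coprime : Coprime m p
  coprime (i∣m , i∣p) with prime⇒irreducible p-prime i∣p
  ... | inj₁ i≡1 = i≡1
  ... | inj₂ refl = contradiction i∣m p∤m

theorem1p1 : (c d : ℕ) → .{{NonZero c}} → .{{NonZero d}} → (r : ℤ) →
    (∃[ N ] ((n : ℕ) → N ≤ n → Representable c r d n)) →
    IsPowerOfTwo c × IsPowerOfTwo d × gcd r (+ d) ≡ + 1
theorem1p1 c d r eventually = powerOfTwo c inj₁ , d-power , coprime
  where
  powerOfTwo : ∀ m → .{{NonZero m}} → (∀ {q} → q ∣ m → q ∣ c ⊎ q ∣ d) → IsPowerOfTwo m
  powerOfTwo m divisor = fromInj₁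
    (λ (h , q∣m) → contradiction eventually
      (oddDivisor⇒¬eventuallyRepresentable {c} {d} {r} h (divisor q∣m)))
    (powerOfTwo⊎oddDivisor m)
  d-power : IsPowerOfTwo d
  d-power = powerOfTwo d inj₂
  g = ℕ.gcd (ℤ.∣ r ∣) d
  g∣2^k : g ∣ 2 ^ proj₁ d-power
  g∣2^k = subst (g ∣_) (proj₂ d-power) (gcd[m,n]∣n (ℤ.∣ r ∣) d)
  2∤g : ¬ 2 ∣ g
  2∤g 2∣g = evenResidue⇒¬eventuallyRepresentable {c} {d} {r}
    (∣-trans 2∣g (gcd[m,n]∣n (ℤ.∣ r ∣) d)) (∣-trans 2∣g (gcd[m,n]∣m (ℤ.∣ r ∣) d)) eventually
  coprime : gcd r (+ d) ≡ + 1
  coprime = [ cong (+_) , ⊥-elim ∘ 2∤g ]′ (∣p^k⇒≡1⊎p∣ prime[2] (proj₁ d-power) g∣2^k)
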